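{- Let $n \geqslant 6$ and let $k,l$ be integers with $k\geqslant 2$, $l \geqslant k+1$, $k\leqslant n$ and $n-l\geqslant 2$. If $l$ divides $n+1$, then $\langle r_n, r_{n-l}, r_k\rangle$ is a proper subgroup of $\mathrm{Sym}_n$.
   Context: $\mathrm{Sym}_n$ is the symmetric group acting naturally on $\{1,\dots,n\}$. For $1< i\leqslant n$, the prefix reversal $r_i\in\mathrm{Sym}_n$ is the permutation with $r_i(j)=i+1-j$ for $1\leqslant j\leqslant i$ and $r_i(j)=j$ for $i<j\leqslant n$. -}

module Defs where

open import Data.Nat using (ℕ; zero; suc; _∸_; _≤_; _<_; _≤?_; s≤s)
open import Data.Nat.Properties using (m∸n≤m; m∸[m∸n]≡n; ≤-trans; s≤s-injective)
open import Data.Fin using (Fin; toℕ; fromℕ<)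
open import Data.Fin.Properties using (toℕ-fromℕ<; toℕ-injective)
open import Data.Fin.Permutation using (Permutation′; permutation; id; flip; _∘ₚ_; _⟨$⟩ʳ_)
open import Data.List using (List)
open import Data.List.Membership.Propositional using (_∈_)
open import Relation.Nullary using (Dec; yes; no; ¬_; contradiction)
open import Relation.Binary.PropositionalEquality using (_≡_; refl; sym; trans; cong; subst)
open import Data.Product using (∃)

-- Points of {1,…,n} are represented by Fin n, with point j+1 ↦ (j : Fin n).
-- prefixRevFun i is the prefix reversal r_i (for 1 < i ≤ n):
-- the point with 0-based index j < i goes to index (i - 1) - j, others fixed.
-- (For i > n or i ≤ 1 it is the identity; it is only used with 1 < i ≤ n.)
revAux : {n : ℕ} (p : ℕ) (j : Fin n) → Dec (toℕ j ≤ p) → Dec (suc p ≤ n) → Fin n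
revAux p j (yes _) (yes i≤n) = fromℕ< {p ∸ toℕ j} (≤-trans (s≤s (m∸n≤m p (toℕ j))) i≤n)
revAux p j (yes _) (no _) = j
revAux p j (no _) _ = j

prefixRevFun : {n : ℕ} → ℕ → Fin n → Fin n
prefixRevFun zero j = j
prefixRevFun {n} (suc p) j = revAux p j (toℕ j ≤? p) (suc p ≤? n)

revAux-invol : {n : ℕ} (p : ℕ) (j : Fin n) (d1 : Dec (toℕ j ≤ p)) (d2 d2' : Dec (suc p ≤ n))
  (d1' : Dec (toℕ (revAux p j d1 d2) ≤ p)) → revAux p (revAux p j d1 d2) d1' d2' ≡ j
revAux-invol p j (yes j≤p) (yes i≤n) (yes i≤n') (yes _) =
  toℕ-injective (trans (toℕ-fromℕ< lt2) (trans (cong (p ∸_) (toℕ-fromℕ< lt1)) (m∸[m∸n]≡n j≤p)))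
  where
  lt1 = ≤-trans (s≤s (m∸n≤m p (toℕ j))) i≤n
  lt2 = ≤-trans (s≤s (m∸n≤m p (toℕ (fromℕ< lt1)))) i≤n'
revAux-invol p j (yes j≤p) (yes i≤n) (no ¬i) (yes _) = contradiction i≤n ¬i
revAux-invol p j (yes j≤p) (yes i≤n) _ (no ¬q) =
  contradiction (subst (_≤ p) (sym (toℕ-fromℕ< (≤-trans (s≤s (m∸n≤m p (toℕ j))) i≤n))) (m∸n≤m p (toℕ j))) ¬q
revAux-invol p j (yes j≤p) (no ¬i) (yes i≤n) (yes _) = contradiction i≤n ¬i
revAux-invol p j (yes j≤p) (no _) (no _) (yes _) = refl
revAux-invol p j (yes j≤p) (no _) _ (no _) = refl
revAux-invol p j (no ¬q) d2 _ (yes q) = contradiction q ¬q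
revAux-invol p j (no _) d2 _ (no _) = refl

prefixRevFun-invol : {n : ℕ} (i : ℕ) (j : Fin n) → prefixRevFun i (prefixRevFun i j) ≡ j
prefixRevFun-invol zero j = refl
prefixRevFun-invol {n} (suc p) j = revAux-invol p j (toℕ j ≤? p) (suc p ≤? n) (suc p ≤? n) (toℕ (prefixRevFun (suc p) j) ≤? p)

prefixRev : (n i : ℕ) → Permutation′ n
prefixRev n i = permutation (prefixRevFun i) (prefixRevFun i)
  (prefixRevFun-invol i) (prefixRevFun-invol i)

data InSubgroupGen {n : ℕ} (gens : List (Permutation′ n)) : Permutation′ n → Set where
  gen   : ∀ {g} → g ∈ gens → InSubgroupGen gens g
  ident : InSubgroupGen gens id
  comp  : ∀ {p q} → InSubgroupGen gens p → InSubgroupGen gens q → InSubgroupGen gens (p ∘ₚ q)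
  inv   : ∀ {p} → InSubgroupGen gens p → InSubgroupGen gens (flip p)
  ext   : ∀ {p q} → InSubgroupGen gens p → (∀ x → p ⟨$⟩ʳ x ≡ q ⟨$⟩ʳ x) → InSubgroupGen gens q

ProperSubgroupGen : {n : ℕ} → List (Permutation′ n) → Set
ProperSubgroupGen {n} gens = ∃ λ (σ : Permutation′ n) → ¬ InSubgroupGen gens σ

-- The points of {1,…,n} divisible by l form a block that each generator maps to itself:
-- r_n and r_{n-l} are reflections x ↦ i+1-x about centres with l ∣ i+1, and r_k only moves
-- points below l. Since l ≤ n and l ≥ 3, the transposition (1 l) leaves the block and so
-- cannot lie in the generated subgroup.
{-# OPTIONS --safe #-}
module Submission where

open import Defs
open import Data.Nat using (ℕ; zero; suc; _+_; _∸_; _≤_; _<_; s≤s; _≤?_)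
open import Data.Nat.Properties
  using (+-suc; +-comm; m+[n∸m]≡n; m∸n+n≡m; m≤m+n; ≤-trans; <-trans; ≤-reflexive; <⇒≱)
open import Data.Nat.Divisibility using (_∣_; ∣-refl; ∣m+n∣m⇒∣n; ∣⇒≤)
open import Data.Fin using (Fin; toℕ; fromℕ<)
open import Data.Fin.Patterns using (0F)
open import Data.Fin.Properties using (toℕ-fromℕ<)
open import Data.Fin.Permutation using (Permutation′; flip; inverseʳ; transpose; _⟨$⟩ʳ_; _⟨$⟩ˡ_)
open import Data.List using (List; _∷_; [])
open import Data.List.Relation.Unary.All as All using (All; _∷_; [])
open import Data.Product using (_,_)
open import Data.Sum using (_⊎_; inj₁; inj₂)
open import Function using (_∘_)
open import Function.Bundles using (_⇔_; mk⇔; Equivalence)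
open import Function.Construct.Identity using (⇔-id)
open import Function.Construct.Composition using (_⇔-∘_)
open import Function.Construct.Symmetry using (⇔-sym)
open import Relation.Nullary using (¬_; Dec; yes; no; contradiction)
open import Relation.Binary.PropositionalEquality using (_≡_; refl; sym; trans; cong; subst; module ≡-Reasoning)

Preserves : {n : ℕ} → (Fin n → Set) → Permutation′ n → Set
Preserves P σ = ∀ x → P x ⇔ P (σ ⟨$⟩ʳ x)

preserves-inverse : {n : ℕ} {P : Fin n → Set} {σ : Permutation′ n} →
  Preserves P σ → Preserves P (flip σ)
preserves-inverse {P = P} {σ} pres y =
  ⇔-sym (subst (λ z → P (σ ⟨$⟩ˡ y) ⇔ P z) (inverseʳ σ) (pres (σ ⟨$⟩ˡ y)))

preserved-by-generated : {n : ℕ} {P : Fin n → Set} {gens : List (Permutation′ n)} {σ : Permutation′ n} →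
  All (Preserves P) gens → InSubgroupGen gens σ → Preserves P σ
preserved-by-generated all (gen σ∈gens) = All.lookup all σ∈gens
preserved-by-generated all ident x = ⇔-id _
preserved-by-generated all (comp {σ} σ∈ τ∈) x =
  preserved-by-generated all τ∈ (σ ⟨$⟩ʳ x) ⇔-∘ preserved-by-generated all σ∈ x
preserved-by-generated all (inv {σ} σ∈) = preserves-inverse {σ = σ} (preserved-by-generated all σ∈)
preserved-by-generated {P = P} all (ext σ∈ σ≗τ) x =
  subst (λ y → P x ⇔ P y) (σ≗τ x) (preserved-by-generated all σ∈ x)

-- On 0-based indices, r_i swaps a and b exactly when a + b = i - 1.
MirrorClosed : (ℕ → Set) → ℕ → Set
MirrorClosed P i = ∀ a b → suc (a + b) ≡ i → P a → P b

revAux-fixes-or-mirrors : {n : ℕ} (p : ℕ) (x : Fin n)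
  (x≤p? : Dec (toℕ x ≤ p)) (i≤n? : Dec (suc p ≤ n)) →
  toℕ (revAux {n} p x x≤p? i≤n?) ≡ toℕ x ⊎ suc (toℕ (revAux p x x≤p? i≤n?) + toℕ x) ≡ suc p
revAux-fixes-or-mirrors p x (yes x≤p) (yes i≤n) = inj₂ (begin
  suc (toℕ (fromℕ< _) + toℕ x) ≡⟨ cong (λ y → suc (y + toℕ x)) (toℕ-fromℕ< _) ⟩
  suc (p ∸ toℕ x + toℕ x)      ≡⟨ cong suc (m∸n+n≡m x≤p) ⟩
  suc p                        ∎)
  where open ≡-Reasoning
revAux-fixes-or-mirrors p x (yes _) (no _) = inj₁ refl
revAux-fixes-or-mirrors p x (no _) _ = inj₁ refl

prefixRev-fixes-or-mirrors : {n : ℕ} (i : ℕ) (x : Fin n) →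
  toℕ (prefixRev n i ⟨$⟩ʳ x) ≡ toℕ x ⊎ suc (toℕ (prefixRev n i ⟨$⟩ʳ x) + toℕ x) ≡ i
prefixRev-fixes-or-mirrors zero x = inj₁ refl
prefixRev-fixes-or-mirrors (suc p) x = revAux-fixes-or-mirrors p x (toℕ x ≤? p) (suc p ≤? _)

prefixRev-preserves : {n i : ℕ} {P : ℕ → Set} → MirrorClosed P i → Preserves (P ∘ toℕ) (prefixRev n i)
prefixRev-preserves {n} {i} {P} closed x with prefixRev-fixes-or-mirrors {n} i x
... | inj₁ fixed = subst (λ y → P (toℕ x) ⇔ P y) (sym fixed) (⇔-id _)
... | inj₂ mirrored =
  mk⇔ (closed _ _ (trans (cong suc (+-comm (toℕ x) _)) mirrored)) (closed _ _ mirrored)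

∣1+-mirrorClosed : {l i : ℕ} → l ∣ suc i → MirrorClosed (λ a → l ∣ suc a) i
∣1+-mirrorClosed {l} l∣1+i a b mirror =
  ∣m+n∣m⇒∣n (subst (l ∣_) (sym (cong suc (trans (+-suc a b) mirror))) l∣1+i)

∣1+-mirrorClosed-below : {l i : ℕ} → i < l → MirrorClosed (λ a → l ∣ suc a) i
∣1+-mirrorClosed-below {l} i<l a b mirror l∣1+a =
  contradiction (∣⇒≤ l∣1+a) (<⇒≱ (≤-trans (s≤s (≤-trans (s≤s (m≤m+n a b)) (≤-reflexive mirror))) i<l))

∣1+n⇒∣1+[n∸d] : {d n : ℕ} → d ≤ n → d ∣ suc n → d ∣ suc (n ∸ d)
∣1+n⇒∣1+[n∸d] {d} {n} d≤n d∣1+n =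
  ∣m+n∣m⇒∣n (subst (d ∣_) (sym (trans (+-suc d (n ∸ d)) (cong suc (m+[n∸m]≡n d≤n)))) d∣1+n) ∣-refl

mainTheorem2 : (n k l : ℕ) → 6 ≤ n → 2 ≤ k → suc k ≤ l → k ≤ n → l + 2 ≤ n →
    l ∣ suc n →
    ProperSubgroupGen (prefixRev n n ∷ prefixRev n (n ∸ l) ∷ prefixRev n k ∷ [])
mainTheorem2 n k zero _ _ () _ _ _
mainTheorem2 zero k (suc _) _ _ _ _ () _
mainTheorem2 n@(suc _) k l@(suc _) _ 1<k k<l _ l+2≤n l∣1+n = σ , σ∉
  where
  l≤n : l ≤ n
  l≤n = ≤-trans (m≤m+n l 2) l+2≤n

  σ : Permutation′ n
  σ = transpose 0F (fromℕ< l≤n)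

  generators-preserve : All (Preserves ((λ a → l ∣ suc a) ∘ toℕ))
                            (prefixRev n n ∷ prefixRev n (n ∸ l) ∷ prefixRev n k ∷ [])
  generators-preserve =
    prefixRev-preserves (∣1+-mirrorClosed l∣1+n) ∷
    prefixRev-preserves (∣1+-mirrorClosed (∣1+n⇒∣1+[n∸d] l≤n l∣1+n)) ∷
    prefixRev-preserves (∣1+-mirrorClosed-below k<l) ∷ []

  σ∉ : ¬ InSubgroupGen _ σ
  σ∉ σ∈ = <⇒≱ (<-trans 1<k k<l) (∣⇒≤ l∣1)
    where
    l∣σ0 : l ∣ suc (toℕ (fromℕ< l≤n))
    l∣σ0 = subst (λ y → l ∣ suc y) (sym (toℕ-fromℕ< l≤n)) ∣-refl

    l∣1 : l ∣ 1
    l∣1 = Equivalence.from (preserved-by-generated generators-preserve σ∈ 0F) l∣σ0
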